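{- Let $G=G[X,Y]$ be a bipartite multigraph with parts $X,Y$ satisfying $|X|=|Y|=n$. Suppose that $\delta^s(G)\ge t$ for some integer $t\in[1,n-1]$, and that all but at most $t$ vertices of $G$ have simple degree at least $\frac n2$ in $G$. Then $G$ has a perfect matching.
   Context: A multigraph may have multiple edges but no loops. The simple degree of a vertex $v$ is $|N_G(v)|$, the number of distinct neighbors of $v$, and $\delta^s(G)$ is the minimum simple degree over all vertices of $G$. $[p,q]=\{i\in\mathbb{Z}:p\le i\le q\}$. -}

module Defs where

open import Data.Nat using (ℕ; zero; suc; _+_; _*_; _≤_; _<_)
open import Data.Nat.Properties using (_<?_)
open import Data.Fin using (Fin)
open import Data.Product using (Σ; _×_)
open import Data.Sum using (_⊎_)
open import Function.Definitions using (Injective)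
open import Relation.Binary.PropositionalEquality using (_≡_)
open import Relation.Nullary using (Dec; yes; no)

count : ∀ {n} {P : Fin n → Set} → ((i : Fin n) → Dec (P i)) → ℕ
count {zero} d = 0
count {suc n} d with d Fin.zero
... | yes _ = suc (count {n} (λ i → d (Fin.suc i)))
... | no  _ = count {n} (λ i → d (Fin.suc i))

-- A bipartite multigraph G[X,Y] with |X| = |Y| = n, X = Y = Fin n
-- (as index sets), given by edge multiplicities mult x y (no loops
-- are possible since edges only join X to Y).
BipMultigraph : ℕ → Set
BipMultigraph n = Fin n → Fin n → ℕ

Adj : ∀ {n} → BipMultigraph n → Fin n → Fin n → Set
Adj G x y = 1 ≤ G x y

adj? : ∀ {n} (G : BipMultigraph n) x y → Dec (Adj G x y)
adj? G x y = 0 <? G x y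

sdegX : ∀ {n} → BipMultigraph n → Fin n → ℕ
sdegX G x = count (λ y → adj? G x y)

sdegY : ∀ {n} → BipMultigraph n → Fin n → ℕ
sdegY G y = count (λ x → adj? G x y)

MinSimpleDegGE : ∀ {n} → BipMultigraph n → ℕ → Set
MinSimpleDegGE G t = (∀ x → t ≤ sdegX G x) × (∀ y → t ≤ sdegY G y)

-- number of vertices (in X ∪ Y) with simple degree < n/2, i.e. 2·deg < n
numLowX : ∀ {n} → BipMultigraph n → ℕ
numLowX {n} G = count (λ x → 2 * sdegX G x <? n)

numLowY : ∀ {n} → BipMultigraph n → ℕ
numLowY {n} G = count (λ y → 2 * sdegY G y <? n)

-- a perfect matching: an injective map X → Y along edges
-- (injective on the finite set Fin n, hence a bijection)
HasPerfectMatching : ∀ {n} → BipMultigraph n → Set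
HasPerfectMatching {n} G =
  Σ (Fin n → Fin n) (λ σ → Injective _≡_ _≡_ σ × (∀ x → Adj G x (σ x)))

{-# OPTIONS --safe #-}
-- By Hall's theorem it suffices that |Γ(S)| ≥ |S| for every S ⊆ X. Suppose |Γ(S)| < |S|.
-- Every vertex has at least t neighbours, so |S| > |Γ(S)| ≥ t and |Y ∖ Γ(S)| > n − |S| ≥ t;
-- as at most t vertices on each side have simple degree below n/2, both S and Y ∖ Γ(S)
-- contain a vertex of simple degree at least n/2. The first has all its neighbours in Γ(S),
-- the second all its neighbours in X ∖ S, so n ≤ 2|Γ(S)| and n ≤ 2(n − |S|), whence
-- 2n ≤ 2(|Γ(S)| + n − |S|) < 2n.
--
-- Hall's theorem is proved by the Halmos–Vaughan induction: if some nonempty proper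
-- S ⊆ D is tight (|Γ(S) ∩ E| ≤ |S|), match S into Γ(S) and D ∖ S into E ∖ Γ(S) separately;
-- otherwise match any x ∈ D to any neighbour y and recurse on D − x, E − y.
module Submission where

open import Defs
open import Data.Nat using (ℕ; zero; suc; _+_; _*_; _∸_; _≤_; _<_; z≤n; _<?_; _≤?_)
open import Data.Nat.Properties
  using (≤-reflexive; ≤-trans; ≤-<-trans; ≰⇒>; ≮⇒≥; <⇒≱; >⇒≢; +-suc; +-comm; +-identityʳ;
         +-cancelʳ-≤; +-cancelʳ-<; +-cancelˡ-<; +-monoˡ-≤; +-monoʳ-≤; m≤m+n; m≤n+m; *-monoʳ-≤; *-monoʳ-<;
         *-distribˡ-+; m+[n∸m]≡n; +-monoˡ-<; ∸-monoʳ-<; module ≤-Reasoning)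
open import Data.Nat.Induction using (<-wellFounded)
open import Data.Fin using (Fin; zero; suc; _≟_)
open import Data.Fin.Properties using (any?)
open import Data.Fin.Subset
open import Data.Fin.Subset.Properties
open import Data.Vec.Base using ([]; _∷_; tabulate; here; there)
open import Data.Vec.Properties using (lookup∘tabulate; lookup⇒[]=; []=⇒lookup)
open import Data.Product using (∃; _×_; _,_; proj₁; proj₂)
open import Data.Sum using (inj₁; inj₂)
open import Function using (_∘_)
open import Function.Definitions using (Injective)
open import Induction.WellFounded using (module All)
open import Level using (0ℓ)
open import Relation.Binary.Construct.On as On using ()
open import Relation.Binary.PropositionalEquality using (_≡_; refl; sym; trans; cong; subst; module ≡-Reasoning)
open import Relation.Nullary using (Dec; yes; no; ¬_; does; contradiction)
open import Relation.Nullary.Decidable using (_×-dec_; dec-true)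

private variable
  m n : ℕ

toSubset : {P : Fin n → Set} → ((i : Fin n) → Dec (P i)) → Subset n
toSubset d = tabulate (does ∘ d)

module _ {P : Fin n → Set} (d : (i : Fin n) → Dec (P i)) where

  ∈toSubset⁺ : ∀ {i} → P i → i ∈ toSubset d
  ∈toSubset⁺ {i} p = lookup⇒[]= i _ (trans (lookup∘tabulate (does ∘ d) i) (dec-true (d i) p))

  ∈toSubset⁻ : ∀ {i} → i ∈ toSubset d → P i
  ∈toSubset⁻ {i} i∈ with d i | trans (sym (lookup∘tabulate (does ∘ d) i)) ([]=⇒lookup i∈)
  ... | yes p | _  = p
  ... | no  _ | ()

count≡∣toSubset∣ : {P : Fin n → Set} (d : (i : Fin n) → Dec (P i)) → count d ≡ ∣ toSubset d ∣
count≡∣toSubset∣ {zero}  d = refl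
count≡∣toSubset∣ {suc n} d with d zero
... | yes _ = cong suc (count≡∣toSubset∣ (d ∘ suc))
... | no  _ = count≡∣toSubset∣ (d ∘ suc)

∣p∪q∣+∣p∩q∣≡∣p∣+∣q∣ : (p q : Subset n) → ∣ p ∪ q ∣ + ∣ p ∩ q ∣ ≡ ∣ p ∣ + ∣ q ∣
∣p∪q∣+∣p∩q∣≡∣p∣+∣q∣ []            []            = refl
∣p∪q∣+∣p∩q∣≡∣p∣+∣q∣ (inside  ∷ p) (inside  ∷ q) =
  cong suc (trans (+-suc _ _) (trans (cong suc (∣p∪q∣+∣p∩q∣≡∣p∣+∣q∣ p q)) (sym (+-suc _ _))))
∣p∪q∣+∣p∩q∣≡∣p∣+∣q∣ (inside  ∷ p) (outside ∷ q) = cong suc (∣p∪q∣+∣p∩q∣≡∣p∣+∣q∣ p q)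
∣p∪q∣+∣p∩q∣≡∣p∣+∣q∣ (outside ∷ p) (inside  ∷ q) =
  trans (cong suc (∣p∪q∣+∣p∩q∣≡∣p∣+∣q∣ p q)) (sym (+-suc _ _))
∣p∪q∣+∣p∩q∣≡∣p∣+∣q∣ (outside ∷ p) (outside ∷ q) = ∣p∪q∣+∣p∩q∣≡∣p∣+∣q∣ p q

∣p∪q∣≤∣p∣+∣q∣ : (p q : Subset n) → ∣ p ∪ q ∣ ≤ ∣ p ∣ + ∣ q ∣
∣p∪q∣≤∣p∣+∣q∣ p q = ≤-trans (m≤m+n _ _) (≤-reflexive (∣p∪q∣+∣p∩q∣≡∣p∣+∣q∣ p q))

Empty⇒∣p∣≡0 : {p : Subset n} → Empty p → ∣ p ∣ ≡ 0
Empty⇒∣p∣≡0 {n} p≡∅ = trans (cong ∣_∣ (Empty-unique p≡∅)) (∣⊥∣≡0 n)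

Empty[p∩q]⇒∣p∣+∣q∣≡∣p∪q∣ : (p q : Subset n) → Empty (p ∩ q) → ∣ p ∣ + ∣ q ∣ ≡ ∣ p ∪ q ∣
Empty[p∩q]⇒∣p∣+∣q∣≡∣p∪q∣ p q disjoint = begin
  ∣ p ∣ + ∣ q ∣          ≡⟨ ∣p∪q∣+∣p∩q∣≡∣p∣+∣q∣ p q ⟨
  ∣ p ∪ q ∣ + ∣ p ∩ q ∣  ≡⟨ cong (∣ p ∪ q ∣ +_) (Empty⇒∣p∣≡0 disjoint) ⟩
  ∣ p ∪ q ∣ + 0          ≡⟨ +-identityʳ _ ⟩
  ∣ p ∪ q ∣              ∎
  where open ≡-Reasoning

x∈p─q⇒x∉q : ∀ {p q : Subset n} {x} → x ∈ p ─ q → x ∉ q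
x∈p─q⇒x∉q {p = inside ∷ _} {outside ∷ _} here ()
x∈p─q⇒x∉q {p = _ ∷ _}      {_ ∷ _}       (there x∈p─q) (there x∈q) = x∈p─q⇒x∉q x∈p─q x∈q

0<∣p∣⇒Nonempty : {p : Subset n} → 0 < ∣ p ∣ → Nonempty p
0<∣p∣⇒Nonempty {p = p} 0<∣p∣ with nonempty? p
... | yes p≢∅ = p≢∅
... | no  p≡∅ = contradiction (Empty⇒∣p∣≡0 p≡∅) (>⇒≢ 0<∣p∣)

∣q∣<∣p∣⇒Nonempty[p─q] : (p q : Subset n) → ∣ q ∣ < ∣ p ∣ → Nonempty (p ─ q)
∣q∣<∣p∣⇒Nonempty[p─q] p q ∣q∣<∣p∣ = 0<∣p∣⇒Nonempty (+-cancelʳ-< (∣ q ∣) 0 (∣ p ─ q ∣) (begin-strict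
  ∣ q ∣                 <⟨ ∣q∣<∣p∣ ⟩
  ∣ p ∣                 ≤⟨ p⊆q⇒∣p∣≤∣q∣ p⊆[p─q]∪q ⟩
  ∣ (p ─ q) ∪ q ∣       ≤⟨ ∣p∪q∣≤∣p∣+∣q∣ (p ─ q) q ⟩
  ∣ p ─ q ∣ + ∣ q ∣     ∎))
  where
  open ≤-Reasoning
  p⊆[p─q]∪q : p ⊆ (p ─ q) ∪ q
  p⊆[p─q]∪q {x} x∈p with x ∈? q
  ... | yes x∈q = x∈p∪q⁺ (inj₂ x∈q)
  ... | no  x∉q = x∈p∪q⁺ (inj₁ (x∈p∧x∉q⇒x∈p─q x∈p x∉q))

module Hall (A : Fin m → Subset n) where

  adjacentTo? : ∀ S y → Dec (∃ λ x → x ∈ S × y ∈ A x)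
  adjacentTo? S y = any? (λ x → (x ∈? S) ×-dec (y ∈? A x))

  Γ : Subset m → Subset n
  Γ S = toSubset (adjacentTo? S)

  Γ⁺ : ∀ {S x y} → x ∈ S → y ∈ A x → y ∈ Γ S
  Γ⁺ x∈S y∈Ax = ∈toSubset⁺ (adjacentTo? _) (_ , x∈S , y∈Ax)

  Γ⁻ : ∀ {S y} → y ∈ Γ S → ∃ λ x → x ∈ S × y ∈ A x
  Γ⁻ = ∈toSubset⁻ (adjacentTo? _)

  Γ-mono : ∀ {S T} → S ⊆ T → Γ S ⊆ Γ T
  Γ-mono S⊆T y∈ΓS with Γ⁻ y∈ΓS
  ... | x , x∈S , y∈Ax = Γ⁺ (S⊆T x∈S) y∈Ax

  HallCondition : Subset m → Subset n → Set
  HallCondition D E = ∀ S → S ⊆ D → ∣ S ∣ ≤ ∣ Γ S ∩ E ∣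

  Tight : Subset m → Subset n → Subset m → Set
  Tight D E S = S ⊆ D × Nonempty S × ∣ S ∣ < ∣ D ∣ × ∣ Γ S ∩ E ∣ ≤ ∣ S ∣

  tight? : ∀ D E S → Dec (Tight D E S)
  tight? D E S = (S ⊆? D) ×-dec nonempty? S ×-dec (∣ S ∣ <? ∣ D ∣) ×-dec (∣ Γ S ∩ E ∣ ≤? ∣ S ∣)

  record Matching (D : Subset m) (E : Subset n) : Set where
    field
      partner           : ∀ {x} → x ∈ D → Fin n
      partner∈E         : ∀ {x} (x∈D : x ∈ D) → partner x∈D ∈ E
      partner∈A         : ∀ {x} (x∈D : x ∈ D) → partner x∈D ∈ A x
      partner-injective : ∀ {x y} (x∈D : x ∈ D) (y∈D : y ∈ D) → partner x∈D ≡ partner y∈D → x ≡ y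

  emptyMatching : ∀ {D E} → Empty D → Matching D E
  emptyMatching D≡∅ = record
    { partner           = λ x∈D → contradiction (_ , x∈D) D≡∅
    ; partner∈E         = λ x∈D → contradiction (_ , x∈D) D≡∅
    ; partner∈A         = λ x∈D → contradiction (_ , x∈D) D≡∅
    ; partner-injective = λ x∈D _ _ → contradiction (_ , x∈D) D≡∅
    }

  singletonMatching : ∀ {x y E} → y ∈ E → y ∈ A x → Matching ⁅ x ⁆ (⁅ y ⁆ ∩ E)
  singletonMatching {x} {y} y∈E y∈Ax = record
    { partner           = λ _ → y
    ; partner∈E         = λ _ → x∈p∩q⁺ (x∈⁅x⁆ y , y∈E)
    ; partner∈A         = λ x′∈⁅x⁆ → subst (λ x′ → y ∈ A x′) (sym (x∈⁅y⁆⇒x≡y x x′∈⁅x⁆)) y∈Ax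
    ; partner-injective = λ x′∈⁅x⁆ x″∈⁅x⁆ _ → trans (x∈⁅y⁆⇒x≡y x x′∈⁅x⁆) (sym (x∈⁅y⁆⇒x≡y x x″∈⁅x⁆))
    }

  joinMatchings : ∀ {D E} S F → Matching S (F ∩ E) → Matching (D ─ S) (E ─ F) → Matching D E
  joinMatchings {D} {E} S F M₁ M₂ = record
    { partner           = partner
    ; partner∈E         = partner∈E
    ; partner∈A         = partner∈A
    ; partner-injective = partner-injective
    }
    where
    module M₁ = Matching M₁
    module M₂ = Matching M₂

    partner : ∀ {x} → x ∈ D → Fin n
    partner {x} x∈D with x ∈? S
    ... | yes x∈S = M₁.partner x∈S
    ... | no  x∉S = M₂.partner (x∈p∧x∉q⇒x∈p─q x∈D x∉S)

    partner∈E : ∀ {x} (x∈D : x ∈ D) → partner x∈D ∈ E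
    partner∈E {x} x∈D with x ∈? S
    ... | yes x∈S = proj₂ (x∈p∩q⁻ F E (M₁.partner∈E x∈S))
    ... | no  x∉S = p─q⊆p E F (M₂.partner∈E _)

    partner∈A : ∀ {x} (x∈D : x ∈ D) → partner x∈D ∈ A x
    partner∈A {x} x∈D with x ∈? S
    ... | yes x∈S = M₁.partner∈A x∈S
    ... | no  x∉S = M₂.partner∈A _

    partner₁∈F : ∀ {x} (x∈S : x ∈ S) → M₁.partner x∈S ∈ F
    partner₁∈F x∈S = proj₁ (x∈p∩q⁻ F E (M₁.partner∈E x∈S))

    partner-injective : ∀ {x y} (x∈D : x ∈ D) (y∈D : y ∈ D) → partner x∈D ≡ partner y∈D → x ≡ y
    partner-injective {x} {y} x∈D y∈D eq with x ∈? S | y ∈? S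
    ... | yes x∈S | yes y∈S = M₁.partner-injective x∈S y∈S eq
    ... | no  x∉S | no  y∉S = M₂.partner-injective _ _ eq
    ... | yes x∈S | no  y∉S = contradiction (subst (_∈ F) eq (partner₁∈F x∈S)) (x∈p─q⇒x∉q (M₂.partner∈E _))
    ... | no  x∉S | yes y∈S = contradiction (subst (_∈ F) (sym eq) (partner₁∈F y∈S)) (x∈p─q⇒x∉q (M₂.partner∈E _))

  HallCondition⇒neighbour : ∀ {D E x} → HallCondition D E → x ∈ D → ∃ λ y → y ∈ E × y ∈ A x
  HallCondition⇒neighbour {D} {E} {x} hall x∈D with 0<∣p∣⇒Nonempty 0<∣Γ⁅x⁆∩E∣
    where
    ⁅x⁆⊆D : ⁅ x ⁆ ⊆ D
    ⁅x⁆⊆D x′∈⁅x⁆ = subst (_∈ D) (sym (x∈⁅y⁆⇒x≡y x x′∈⁅x⁆)) x∈D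
    0<∣Γ⁅x⁆∩E∣ : 0 < ∣ Γ ⁅ x ⁆ ∩ E ∣
    0<∣Γ⁅x⁆∩E∣ = subst (_≤ ∣ Γ ⁅ x ⁆ ∩ E ∣) (∣⁅x⁆∣≡1 x) (hall ⁅ x ⁆ ⁅x⁆⊆D)
  ... | y , y∈Γ⁅x⁆∩E with x∈p∩q⁻ (Γ ⁅ x ⁆) E y∈Γ⁅x⁆∩E
  ... | y∈Γ⁅x⁆ , y∈E with Γ⁻ y∈Γ⁅x⁆
  ... | x′ , x′∈⁅x⁆ , y∈Ax′ = y , y∈E , subst (λ x″ → y ∈ A x″) (x∈⁅y⁆⇒x≡y x x′∈⁅x⁆) y∈Ax′

  HallCondition-⊆ : ∀ {D E S} → S ⊆ D → HallCondition D E → HallCondition S (Γ S ∩ E)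
  HallCondition-⊆ {D} {E} {S} S⊆D hall T T⊆S =
    ≤-trans (hall T (⊆-trans T⊆S S⊆D)) (p⊆q⇒∣p∣≤∣q∣ ΓT∩E⊆ΓT∩ΓS∩E)
    where
    ΓT∩E⊆ΓT∩ΓS∩E : Γ T ∩ E ⊆ Γ T ∩ (Γ S ∩ E)
    ΓT∩E⊆ΓT∩ΓS∩E y∈ with x∈p∩q⁻ (Γ T) E y∈
    ... | y∈ΓT , y∈E = x∈p∩q⁺ (y∈ΓT , x∈p∩q⁺ (Γ-mono T⊆S y∈ΓT , y∈E))

  HallCondition-─ : ∀ {D E S} → S ⊆ D → ∣ Γ S ∩ E ∣ ≤ ∣ S ∣ → HallCondition D E →
                    HallCondition (D ─ S) (E ─ Γ S)
  HallCondition-─ {D} {E} {S} S⊆D tight hall T T⊆D─S = +-cancelʳ-≤ ∣ S ∣ ∣ T ∣ _ (begin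
    ∣ T ∣ + ∣ S ∣                                  ≡⟨ Empty[p∩q]⇒∣p∣+∣q∣≡∣p∪q∣ T S T∩S≡∅ ⟩
    ∣ T ∪ S ∣                                      ≤⟨ hall (T ∪ S) T∪S⊆D ⟩
    ∣ Γ (T ∪ S) ∩ E ∣                              ≤⟨ p⊆q⇒∣p∣≤∣q∣ split ⟩
    ∣ Γ T ∩ (E ─ Γ S) ∪ Γ S ∩ E ∣                  ≤⟨ ∣p∪q∣≤∣p∣+∣q∣ (Γ T ∩ (E ─ Γ S)) (Γ S ∩ E) ⟩
    ∣ Γ T ∩ (E ─ Γ S) ∣ + ∣ Γ S ∩ E ∣              ≤⟨ +-monoʳ-≤ ∣ Γ T ∩ (E ─ Γ S) ∣ tight ⟩
    ∣ Γ T ∩ (E ─ Γ S) ∣ + ∣ S ∣                    ∎)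
    where
    open ≤-Reasoning
    T∩S≡∅ : Empty (T ∩ S)
    T∩S≡∅ (x , x∈T∩S) with x∈p∩q⁻ T S x∈T∩S
    ... | x∈T , x∈S = x∈p─q⇒x∉q (T⊆D─S x∈T) x∈S
    T∪S⊆D : T ∪ S ⊆ D
    T∪S⊆D x∈T∪S with x∈p∪q⁻ T S x∈T∪S
    ... | inj₁ x∈T = p─q⊆p D S (T⊆D─S x∈T)
    ... | inj₂ x∈S = S⊆D x∈S
    split : Γ (T ∪ S) ∩ E ⊆ Γ T ∩ (E ─ Γ S) ∪ Γ S ∩ E
    split {y} y∈ with x∈p∩q⁻ (Γ (T ∪ S)) E y∈
    ... | y∈Γ[T∪S] , y∈E with y ∈? Γ S | Γ⁻ y∈Γ[T∪S]
    ... | yes y∈ΓS | _ = x∈p∪q⁺ (inj₂ (x∈p∩q⁺ (y∈ΓS , y∈E)))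
    ... | no  y∉ΓS | x , x∈T∪S , y∈Ax with x∈p∪q⁻ T S x∈T∪S
    ... | inj₁ x∈T = x∈p∪q⁺ (inj₁ (x∈p∩q⁺ (Γ⁺ x∈T y∈Ax , x∈p∧x∉q⇒x∈p─q y∈E y∉ΓS)))
    ... | inj₂ x∈S = contradiction (Γ⁺ x∈S y∈Ax) y∉ΓS

  HallCondition-- : ∀ {D E x y} → x ∈ D → ¬ ∃ (Tight D E) → HallCondition D E →
                    HallCondition (D - x) (E - y)
  HallCondition-- {D} {E} {x} {y} x∈D no-tight hall T T⊆D-x with nonempty? T
  ... | no  T≡∅ = ≤-trans (≤-reflexive (Empty⇒∣p∣≡0 T≡∅)) z≤n
  ... | yes T≢∅ with ∣ Γ T ∩ E ∣ ≤? ∣ T ∣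
  ... | yes T-tight = contradiction (T , (λ {z} → T⊆D {z}) , T≢∅ , ∣T∣<∣D∣ , T-tight) no-tight
    where
    T⊆D : T ⊆ D
    T⊆D z∈T = p─q⊆p D ⁅ x ⁆ (T⊆D-x z∈T)
    ∣T∣<∣D∣ : ∣ T ∣ < ∣ D ∣
    ∣T∣<∣D∣ = ≤-<-trans (p⊆q⇒∣p∣≤∣q∣ T⊆D-x) (x∈p⇒∣p-x∣<∣p∣ x∈D)
  ... | no  T-loose = +-cancelʳ-≤ 1 ∣ T ∣ _ (begin
    ∣ T ∣ + 1                        ≡⟨ +-comm ∣ T ∣ 1 ⟩
    suc ∣ T ∣                        ≤⟨ ≰⇒> T-loose ⟩
    ∣ Γ T ∩ E ∣                      ≤⟨ p⊆q⇒∣p∣≤∣q∣ split ⟩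
    ∣ Γ T ∩ (E - y) ∪ ⁅ y ⁆ ∣        ≤⟨ ∣p∪q∣≤∣p∣+∣q∣ (Γ T ∩ (E - y)) ⁅ y ⁆ ⟩
    ∣ Γ T ∩ (E - y) ∣ + ∣ ⁅ y ⁆ ∣    ≡⟨ cong (∣ Γ T ∩ (E - y) ∣ +_) (∣⁅x⁆∣≡1 y) ⟩
    ∣ Γ T ∩ (E - y) ∣ + 1            ∎)
    where
    open ≤-Reasoning
    split : Γ T ∩ E ⊆ Γ T ∩ (E - y) ∪ ⁅ y ⁆
    split {y′} y′∈ with y′ ≟ y | x∈p∩q⁻ (Γ T) E y′∈
    ... | yes refl | _             = x∈p∪q⁺ (inj₂ (x∈⁅x⁆ y))
    ... | no  y′≢y | y′∈ΓT , y′∈E = x∈p∪q⁺ (inj₁ (x∈p∩q⁺ (y′∈ΓT , x∈p∧x≢y⇒x∈p-y y′∈E y′≢y)))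

  HasMatchings : Subset m → Set
  HasMatchings D = ∀ E → HallCondition D E → Matching D E

  matching-step : ∀ D → (∀ {D′} → ∣ D′ ∣ < ∣ D ∣ → HasMatchings D′) → HasMatchings D
  matching-step D ih E hall with nonempty? D
  ... | no  D≡∅ = emptyMatching D≡∅
  ... | yes (x , x∈D) with anySubset? (tight? D E)
  ... | yes (S , S⊆D , (z , z∈S) , ∣S∣<∣D∣ , tight) =
    joinMatchings S (Γ S)
      (ih ∣S∣<∣D∣ (Γ S ∩ E) (HallCondition-⊆ S⊆D hall))
      (ih (p∩q≢∅⇒∣p─q∣<∣p∣ D S (z , x∈p∩q⁺ (S⊆D z∈S , z∈S))) (E ─ Γ S) (HallCondition-─ S⊆D tight hall))
  ... | no  no-tight with HallCondition⇒neighbour hall x∈D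
  ... | y , y∈E , y∈Ax =
    joinMatchings ⁅ x ⁆ ⁅ y ⁆
      (singletonMatching y∈E y∈Ax)
      (ih (x∈p⇒∣p-x∣<∣p∣ x∈D) (E - y) (HallCondition-- x∈D no-tight hall))

  matching : ∀ D E → HallCondition D E → Matching D E
  matching = All.wfRec (On.wellFounded ∣_∣ <-wellFounded) 0ℓ HasMatchings matching-step

  hall : (∀ S → ∣ S ∣ ≤ ∣ Γ S ∣) → ∃ λ (f : Fin m → Fin n) → Injective _≡_ _≡_ f × ∀ x → f x ∈ A x
  hall hall-condition = (λ x → partner (∈⊤ {x = x})) , partner-injective ∈⊤ ∈⊤ , λ x → partner∈A ∈⊤
    where
    open Matching (matching ⊤ ⊤ λ S _ → subst (∣ S ∣ ≤_) (cong ∣_∣ (sym (∩-identityʳ (Γ S)))) (hall-condition S))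

Low : (Fin n → ℕ) → Subset n
Low {n} deg = toSubset (λ i → 2 * deg i <? n)

∉Low⇒n≤2*deg : ∀ (deg : Fin n → ℕ) {i} → i ∉ Low deg → n ≤ 2 * deg i
∉Low⇒n≤2*deg {n} deg {i} i∉Low = ≮⇒≥ (i∉Low ∘ ∈toSubset⁺ (λ j → 2 * deg j <? n))

bounded-degree-set⇒n≤2*bound : ∀ {t b} (deg : Fin n → ℕ) (P : Subset n) →
  (∀ i → t ≤ deg i) → ∣ Low deg ∣ ≤ t → (∀ {i} → i ∈ P → deg i ≤ b) → b < ∣ P ∣ → n ≤ 2 * b
bounded-degree-set⇒n≤2*bound {t = t} {b} deg P t≤deg ∣Low∣≤t deg≤b b<∣P∣
  with 0<∣p∣⇒Nonempty (≤-<-trans z≤n b<∣P∣)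
... | i , i∈P with ∣q∣<∣p∣⇒Nonempty[p─q] P (Low deg) ∣Low∣<∣P∣
  where
  open ≤-Reasoning
  ∣Low∣<∣P∣ : ∣ Low deg ∣ < ∣ P ∣
  ∣Low∣<∣P∣ = begin-strict
    ∣ Low deg ∣  ≤⟨ ∣Low∣≤t ⟩
    t            ≤⟨ t≤deg i ⟩
    deg i        ≤⟨ deg≤b i∈P ⟩
    b            <⟨ b<∣P∣ ⟩
    ∣ P ∣        ∎
... | j , j∈P─Low =
  ≤-trans (∉Low⇒n≤2*deg deg (x∈p─q⇒x∉q j∈P─Low)) (*-monoʳ-≤ 2 (deg≤b (p─q⊆p P (Low deg) j∈P─Low)))

2*[n∸s]<n : ∀ {a s} → a < s → s ≤ n → n ≤ 2 * a → 2 * (n ∸ s) < n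
2*[n∸s]<n {n} {a} {s} a<s s≤n n≤2*a = +-cancelˡ-< n (2 * (n ∸ s)) n (begin-strict
  n + 2 * (n ∸ s)      ≤⟨ +-monoˡ-≤ (2 * (n ∸ s)) n≤2*a ⟩
  2 * a + 2 * (n ∸ s)  ≡⟨ *-distribˡ-+ 2 a (n ∸ s) ⟨
  2 * (a + (n ∸ s))    <⟨ *-monoʳ-< 2 (+-monoˡ-< (n ∸ s) a<s) ⟩
  2 * (s + (n ∸ s))    ≡⟨ cong (2 *_) (m+[n∸m]≡n s≤n) ⟩
  2 * n                ≡⟨ cong (n +_) (+-identityʳ n) ⟩
  n + n                ∎)
  where open ≤-Reasoning

neighbourhood : BipMultigraph n → Fin n → Subset n
neighbourhood G x = toSubset (adj? G x)

module _ {n} (G : BipMultigraph n) where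

  open Hall (neighbourhood G)

  sdegX≤∣Γ∣ : ∀ {S x} → x ∈ S → sdegX G x ≤ ∣ Γ S ∣
  sdegX≤∣Γ∣ {x = x} x∈S =
    subst (_≤ _) (sym (count≡∣toSubset∣ (adj? G x))) (p⊆q⇒∣p∣≤∣q∣ (Γ⁺ x∈S))

  sdegY≤n∸∣S∣ : ∀ {S y} → y ∉ Γ S → sdegY G y ≤ n ∸ ∣ S ∣
  sdegY≤n∸∣S∣ {S} {y} y∉ΓS = begin
    sdegY G y                       ≡⟨ count≡∣toSubset∣ (λ x → adj? G x y) ⟩
    ∣ toSubset (λ x → adj? G x y) ∣  ≤⟨ p⊆q⇒∣p∣≤∣q∣ N[y]⊆∁S ⟩
    ∣ ∁ S ∣                          ≡⟨ ∣∁p∣≡n∸∣p∣ S ⟩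
    n ∸ ∣ S ∣                        ∎
    where
    open ≤-Reasoning
    N[y]⊆∁S : toSubset (λ x → adj? G x y) ⊆ ∁ S
    N[y]⊆∁S {x} x∈N[y] = x∉p⇒x∈∁p λ x∈S →
      y∉ΓS (Γ⁺ x∈S (∈toSubset⁺ (adj? G x) (∈toSubset⁻ (λ x′ → adj? G x′ y) x∈N[y])))

  ∣Γ∣≮∣S∣ : ∀ {t} → MinSimpleDegGE G t → numLowX G + numLowY G ≤ t → ∀ S → ¬ ∣ Γ S ∣ < ∣ S ∣
  ∣Γ∣≮∣S∣ {t} (t≤sdegX , t≤sdegY) few-low S ∣ΓS∣<∣S∣ =
    <⇒≱ (2*[n∸s]<n ∣ΓS∣<∣S∣ (∣p∣≤n S) n≤2*∣ΓS∣) n≤2*[n∸∣S∣]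
    where
    ∣Low[sdegX]∣≤t : ∣ Low (sdegX G) ∣ ≤ t
    ∣Low[sdegX]∣≤t = subst (_≤ t) (count≡∣toSubset∣ (λ x → 2 * sdegX G x <? n))
      (≤-trans (m≤m+n (numLowX G) (numLowY G)) few-low)
    ∣Low[sdegY]∣≤t : ∣ Low (sdegY G) ∣ ≤ t
    ∣Low[sdegY]∣≤t = subst (_≤ t) (count≡∣toSubset∣ (λ y → 2 * sdegY G y <? n))
      (≤-trans (m≤n+m (numLowY G) (numLowX G)) few-low)
    n≤2*∣ΓS∣ : n ≤ 2 * ∣ Γ S ∣
    n≤2*∣ΓS∣ = bounded-degree-set⇒n≤2*bound (sdegX G) S t≤sdegX ∣Low[sdegX]∣≤t sdegX≤∣Γ∣ ∣ΓS∣<∣S∣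
    n≤2*[n∸∣S∣] : n ≤ 2 * (n ∸ ∣ S ∣)
    n≤2*[n∸∣S∣] = bounded-degree-set⇒n≤2*bound (sdegY G) (∁ (Γ S)) t≤sdegY ∣Low[sdegY]∣≤t
      (λ y∈∁ΓS → sdegY≤n∸∣S∣ (x∈∁p⇒x∉p y∈∁ΓS))
      (subst (n ∸ ∣ S ∣ <_) (sym (∣∁p∣≡n∸∣p∣ (Γ S))) (∸-monoʳ-< ∣ΓS∣<∣S∣ (∣p∣≤n S)))

lemma2p8 : (n t : ℕ) (G : BipMultigraph n) →
    1 ≤ t → t ≤ n ∸ 1 →
    MinSimpleDegGE G t →
    numLowX G + numLowY G ≤ t →
    HasPerfectMatching G
lemma2p8 n t G _ _ min-degree few-low =
  let σ , σ-injective , σ-adjacent = Hall.hall (neighbourhood G) (λ S → ≮⇒≥ (∣Γ∣≮∣S∣ G min-degree few-low S))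
  in σ , σ-injective , λ x → ∈toSubset⁻ (adj? G x) (σ-adjacent x)
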